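{- Let $T$ be a finite tree and $e$ an edge of $T$ with endpoints $v_1$ and $v_2$. Removing $e$ splits $T$ into two trees, $T_1$ containing $v_1$ and $T_2$ containing $v_2$; let $E_1=|E(T_1)|$ and $E_2=|E(T_2)|$. Then $$Q(T,v_1)=\frac{[E_1+1]_q}{[E_2+1]_q}\,Q(T,v_2).$$
   Context: A plane rooted tree is a finite tree with a distinguished vertex (the root), embedded in the plane so that it grows upward from the root. A leaf is a vertex of degree $1$ different from the root. For a leaf $v$ of $T$, $r(T,v)$ denotes the number of edges of $T$ lying to the right of the unique path connecting $v$ with the root, and $T-v$ is the plane rooted tree obtained by deleting $v$ and its incident edge. The plucking polynomial $Q(T)\in\mathbb{Z}[q]$ is defined recursively: if $T$ has a single vertex then $Q(T)=1$; otherwise $Q(T)=\sum_{v \text{ leaf of } T} q^{r(T,v)}Q(T-v)$. It is independent of the chosen plane embedding, so for a tree $T$ and a vertex $v$, $Q(T,v)$ denotes the plucking polynomial of $T$ rooted at $v$ (with any plane embedding). $[n]_q=1+q+\dots+q^{n-1}$. -}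

module Defs where

open import Data.Nat using (ℕ; zero; suc; _+_; _*_)
open import Data.List using (List; []; _∷_; _++_; map; replicate; foldr)
open import Data.Product using (_×_; _,_)
open import Relation.Binary.PropositionalEquality using (_≡_)

-- Plane rooted trees: a vertex together with the ordered (left-to-right)
-- list of subtrees growing upward from it.

data Tree : Set where
  node : List Tree → Tree

mutual
  edges : Tree → ℕ
  edges (node ts) = edgesF ts

  edgesF : List Tree → ℕ
  edgesF []       = 0
  edgesF (t ∷ ts) = suc (edges t) + edgesF ts

-- Polynomials in ℕ[q] ⊆ ℤ[q] as coefficient lists (constant term first),
-- compared coefficientwise (so trailing zeros are irrelevant).

Poly : Set
Poly = List ℕ

coeff : Poly → ℕ → ℕ
coeff []       _       = 0
coeff (a ∷ p)  zero    = a
coeff (a ∷ p)  (suc i) = coeff p i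

infix 4 _≈ₚ_
_≈ₚ_ : Poly → Poly → Set
p ≈ₚ r = ∀ i → coeff p i ≡ coeff r i

infixl 6 _+ₚ_
_+ₚ_ : Poly → Poly → Poly
[]      +ₚ r       = r
(a ∷ p) +ₚ []      = a ∷ p
(a ∷ p) +ₚ (b ∷ r) = (a + b) ∷ (p +ₚ r)

scale : ℕ → Poly → Poly
scale c = map (c *_)

infixl 7 _*ₚ_
_*ₚ_ : Poly → Poly → Poly
[]      *ₚ r = []
(a ∷ p) *ₚ r = scale a r +ₚ (0 ∷ (p *ₚ r))

qpow* : ℕ → Poly → Poly
qpow* k p = replicate k 0 ++ p

one : Poly
one = 1 ∷ []

sumₚ : List Poly → Poly
sumₚ = foldr _+ₚ_ []

qint : ℕ → Poly
qint n = replicate n 1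

-- Leaves and plucking.
-- plucks T lists, for every leaf v of T (a vertex of degree 1 other than
-- the root, i.e. a non-root vertex without children), the pair
-- (r(T,v), T - v), where r(T,v) is the number of edges to the right of
-- the path from v to the root.

mutual
  plucks : Tree → List (ℕ × Tree)
  plucks (node ts) = map (λ { (r , ts') → (r , node ts') }) (plucksF ts)

  plucksF : List Tree → List (ℕ × List Tree)
  plucksF []       = []
  plucksF (t ∷ ts) =
    here t ts ++ map (λ { (r , ts') → (r , t ∷ ts') }) (plucksF ts)

  here : Tree → List Tree → List (ℕ × List Tree)
  here (node []) ts = (edgesF ts , ts) ∷ []
  here (node (c ∷ cs)) ts =
    map (λ { (r , t') → (r + edgesF ts , t' ∷ ts) }) (plucks (node (c ∷ cs)))

-- Q with fuel; each plucking removes exactly one edge, so fuel = edges T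
-- suffices, and a tree with 0 edges is the single vertex (Q = 1).
Qfuel : ℕ → Tree → Poly
Qfuel zero    _ = one
Qfuel (suc n) t = sumₚ (map (λ { (r , t') → qpow* r (Qfuel n t') }) (plucks t))

Q : Tree → Poly
Q t = Qfuel (edges t) t

-- Call the hook of a non-root vertex v the number of vertices in the
-- subtree above v (= the edges of that subtree plus the edge below v).  The
-- plucking polynomial satisfies the q-hook-length formula
--     Q(T) · ∏_{v ≠ root} [hook v]_q  =  [|E(T)|]_q!,
-- which follows by induction on the tree from two facts about forests hanging
-- from a common root: the wedge formula Q(F ++ G) = qbinom(|F|,|G|) Q(F) Q(G)
-- (plucking a leaf of F ++ G plucks it from F or from G) and the stem formula
-- Q(v₀ — T) = Q(T) (a new root below the old one changes nothing).  Rooting T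
-- at v₁ or at v₂ yields the same hooks except at the other endpoint of e,
-- whose hook is E₂ + 1 resp. E₁ + 1.  Comparing the two instances of the
-- hook formula and cancelling the common factor, whose constant term is 1,
-- gives [E₂+1] Q(T,v₁) = [E₁+1] Q(T,v₂).
module Submission where

open import Defs
open import Data.Nat using (ℕ; zero; suc; _+_; _*_; NonZero)
open import Data.Nat.Properties
open import Data.List using (List; []; _∷_; _++_; map)
open import Data.List.Properties using (map-++; map-∘; map-cong; ++-identityʳ)
open import Data.List.Relation.Unary.All as All using (All; []; _∷_)
open import Data.List.Relation.Unary.All.Properties using (map⁺; ++⁺)
open import Data.Product using (_×_; _,_; proj₁; proj₂)
open import Data.Maybe using (nothing)
open import Relation.Binary.PropositionalEquality
import Relation.Binary.Reasoning.Setoid as SetoidReasoning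
open import Algebra.Structures using (IsCommutativeMonoid)
open import Algebra.Bundles using (CommutativeSemiring)
open import Algebra.Structures.Biased using (isCommutativeSemiringˡ)
open import Tactic.RingSolver.Core.AlmostCommutativeRing using (fromCommutativeSemiring)

-- Coefficientwise equality, wrapped in a record so that both polynomials can
-- be recovered by unification (they cannot from the function type _≈ₚ_).
infix 4 _≋_
record _≋_ (p r : Poly) : Set where
  constructor mk
  field get : p ≈ₚ r
open _≋_ public

≋-refl : ∀ {p} → p ≋ p
≋-refl = mk (λ _ → refl)

≋-sym : ∀ {p r} → p ≋ r → r ≋ p
≋-sym (mk e) = mk (λ i → sym (e i))

≋-trans : ∀ {p r s} → p ≋ r → r ≋ s → p ≋ s
≋-trans (mk e) (mk f) = mk (λ i → trans (e i) (f i))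

coeff-+ : ∀ p r i → coeff (p +ₚ r) i ≡ coeff p i + coeff r i
coeff-+ []      r       i       = refl
coeff-+ (a ∷ p) []      i       = sym (+-identityʳ _)
coeff-+ (a ∷ p) (b ∷ r) zero    = refl
coeff-+ (a ∷ p) (b ∷ r) (suc i) = coeff-+ p r i

coeff-scale : ∀ a p i → coeff (scale a p) i ≡ a * coeff p i
coeff-scale a []      i       = sym (*-zeroʳ a)
coeff-scale a (b ∷ p) zero    = refl
coeff-scale a (b ∷ p) (suc i) = coeff-scale a p i

-- (p - p(0)) / q; it lets us read p * r one coefficient at a time.
tailₚ : Poly → Poly
tailₚ []      = []
tailₚ (_ ∷ p) = p

coeff-tailₚ : ∀ p i → coeff (tailₚ p) i ≡ coeff p (suc i)
coeff-tailₚ []      i = refl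
coeff-tailₚ (a ∷ p) i = refl

coeff-*-zero : ∀ p r → coeff (p *ₚ r) 0 ≡ coeff p 0 * coeff r 0
coeff-*-zero []      r = refl
coeff-*-zero (a ∷ p) r =
  trans (coeff-+ (scale a r) (0 ∷ (p *ₚ r)) 0) (trans (+-identityʳ _) (coeff-scale a r 0))

coeff-*-suc : ∀ p r i →
  coeff (p *ₚ r) (suc i) ≡ coeff p 0 * coeff r (suc i) + coeff (tailₚ p *ₚ r) i
coeff-*-suc []      r i = refl
coeff-*-suc (a ∷ p) r i =
  trans (coeff-+ (scale a r) (0 ∷ (p *ₚ r)) (suc i)) (cong (_+ coeff (p *ₚ r) i) (coeff-scale a r (suc i)))

+ₚ-cong : ∀ {p p' r r'} → p ≋ p' → r ≋ r' → p +ₚ r ≋ p' +ₚ r'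
+ₚ-cong {p} {p'} {r} {r'} (mk e) (mk f) =
  mk (λ i → trans (coeff-+ p r i) (trans (cong₂ _+_ (e i) (f i)) (sym (coeff-+ p' r' i))))

+ₚ-comm : ∀ p r → p +ₚ r ≋ r +ₚ p
+ₚ-comm p r = mk (λ i → trans (coeff-+ p r i) (trans (+-comm (coeff p i) _) (sym (coeff-+ r p i))))

+ₚ-assoc : ∀ p r s → (p +ₚ r) +ₚ s ≋ p +ₚ (r +ₚ s)
+ₚ-assoc p r s = mk λ i → begin
    coeff ((p +ₚ r) +ₚ s) i               ≡⟨ coeff-+ (p +ₚ r) s i ⟩
    coeff (p +ₚ r) i + coeff s i          ≡⟨ cong (_+ coeff s i) (coeff-+ p r i) ⟩
    coeff p i + coeff r i + coeff s i     ≡⟨ +-assoc (coeff p i) _ _ ⟩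
    coeff p i + (coeff r i + coeff s i)   ≡⟨ cong (coeff p i +_) (coeff-+ r s i) ⟨
    coeff p i + coeff (r +ₚ s) i          ≡⟨ coeff-+ p (r +ₚ s) i ⟨
    coeff (p +ₚ (r +ₚ s)) i               ∎
  where open ≡-Reasoning

+ₚ-identityʳ : ∀ p → p +ₚ [] ≋ p
+ₚ-identityʳ p = mk (λ i → trans (coeff-+ p [] i) (+-identityʳ _))

+ₚ-congˡ : ∀ {p p'} r → p ≋ p' → p +ₚ r ≋ p' +ₚ r
+ₚ-congˡ r e = +ₚ-cong e (≋-refl {r})

+ₚ-congʳ : ∀ p {r r'} → r ≋ r' → p +ₚ r ≋ p +ₚ r'
+ₚ-congʳ p e = +ₚ-cong (≋-refl {p}) e

cons-cong : ∀ {a p r} → p ≋ r → a ∷ p ≋ a ∷ r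
cons-cong (mk e) = mk λ { zero → refl ; (suc i) → e i }

cons0-*ₚ : ∀ p r → (0 ∷ p) *ₚ r ≋ 0 ∷ (p *ₚ r)
cons0-*ₚ p r = mk λ { zero → coeff-*-zero (0 ∷ p) r ; (suc i) → coeff-*-suc (0 ∷ p) r i }

*ₚ-congˡ : ∀ {p p'} r → p ≋ p' → p *ₚ r ≋ p' *ₚ r
*ₚ-congˡ {p} {p'} r (mk e) = mk (λ i → go i p p' e)
  where
  go : ∀ i p p' → p ≈ₚ p' → coeff (p *ₚ r) i ≡ coeff (p' *ₚ r) i
  go zero p p' e =
    trans (coeff-*-zero p r) (trans (cong (_* coeff r 0) (e 0)) (sym (coeff-*-zero p' r)))
  go (suc i) p p' e = trans (coeff-*-suc p r i)
    (trans (cong₂ _+_ (cong (_* coeff r (suc i)) (e 0)) (go i (tailₚ p) (tailₚ p') tails))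
           (sym (coeff-*-suc p' r i)))
    where
    tails : tailₚ p ≈ₚ tailₚ p'
    tails j = trans (coeff-tailₚ p j) (trans (e (suc j)) (sym (coeff-tailₚ p' j)))

*ₚ-zeroʳ : ∀ p → p *ₚ [] ≋ []
*ₚ-zeroʳ p = mk (λ i → go i p)
  where
  go : ∀ i p → coeff (p *ₚ []) i ≡ 0
  go zero    p = trans (coeff-*-zero p []) (*-zeroʳ (coeff p 0))
  go (suc i) p = trans (coeff-*-suc p [] i) (cong₂ _+_ (*-zeroʳ (coeff p 0)) (go i (tailₚ p)))

*ₚ-consʳ : ∀ p b r → p *ₚ (b ∷ r) ≋ scale b p +ₚ (0 ∷ (p *ₚ r))
*ₚ-consʳ []      b r = mk λ { zero → refl ; (suc i) → refl }
*ₚ-consʳ (a ∷ p) b r = mk λ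
  { zero    → trans (coeff-*-zero (a ∷ p) (b ∷ r)) (trans (*-comm a b) (sym (+-identityʳ _)))
  ; (suc i) → begin
      coeff ((a ∷ p) *ₚ (b ∷ r)) (suc i)
        ≡⟨ coeff-*-suc (a ∷ p) (b ∷ r) i ⟩
      a * coeff r i + coeff (p *ₚ (b ∷ r)) i
        ≡⟨ cong (a * coeff r i +_) (trans (get (*ₚ-consʳ p b r) i) (coeff-+ (scale b p) _ i)) ⟩
      a * coeff r i + (coeff (scale b p) i + coeff (0 ∷ (p *ₚ r)) i)
        ≡⟨ x+[y+z]≡y+[x+z] (a * coeff r i) (coeff (scale b p) i) _ ⟩
      coeff (scale b p) i + (a * coeff r i + coeff (0 ∷ (p *ₚ r)) i)
        ≡⟨ cong (coeff (scale b p) i +_) (lowerTerms i) ⟨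
      coeff (scale b p) i + coeff ((a ∷ p) *ₚ r) i
        ≡⟨ coeff-+ (scale b p) ((a ∷ p) *ₚ r) i ⟨
      coeff (scale b (a ∷ p) +ₚ (0 ∷ ((a ∷ p) *ₚ r))) (suc i)
        ∎ }
  where
  open ≡-Reasoning
  x+[y+z]≡y+[x+z] : ∀ x y z → x + (y + z) ≡ y + (x + z)
  x+[y+z]≡y+[x+z] x y z =
    trans (sym (+-assoc x y z)) (trans (cong (_+ z) (+-comm x y)) (+-assoc y x z))
  lowerTerms : ∀ i → coeff ((a ∷ p) *ₚ r) i ≡ a * coeff r i + coeff (0 ∷ (p *ₚ r)) i
  lowerTerms zero    = trans (coeff-*-zero (a ∷ p) r) (sym (+-identityʳ _))
  lowerTerms (suc i) = coeff-*-suc (a ∷ p) r i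

*ₚ-comm : ∀ p r → p *ₚ r ≋ r *ₚ p
*ₚ-comm []      r = ≋-sym (*ₚ-zeroʳ r)
*ₚ-comm (a ∷ p) r =
  ≋-trans (+ₚ-congʳ (scale a r) (cons-cong (*ₚ-comm p r))) (≋-sym (*ₚ-consʳ r a p))

scale-*ₚ : ∀ a r s → scale a r *ₚ s ≋ scale a (r *ₚ s)
scale-*ₚ a []      s = ≋-refl
scale-*ₚ a (b ∷ r) s = mk λ
  { zero → begin
      coeff (scale a (b ∷ r) *ₚ s) 0        ≡⟨ coeff-*-zero (scale a (b ∷ r)) s ⟩
      a * b * coeff s 0                     ≡⟨ *-assoc a b _ ⟩
      a * (b * coeff s 0)                   ≡⟨ cong (a *_) (coeff-*-zero (b ∷ r) s) ⟨
      a * coeff ((b ∷ r) *ₚ s) 0            ≡⟨ coeff-scale a ((b ∷ r) *ₚ s) 0 ⟨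
      coeff (scale a ((b ∷ r) *ₚ s)) 0      ∎
  ; (suc i) → begin
      coeff (scale a (b ∷ r) *ₚ s) (suc i)
        ≡⟨ coeff-*-suc (scale a (b ∷ r)) s i ⟩
      a * b * coeff s (suc i) + coeff (scale a r *ₚ s) i
        ≡⟨ cong₂ _+_ (*-assoc a b _) (trans (get (scale-*ₚ a r s) i) (coeff-scale a (r *ₚ s) i)) ⟩
      a * (b * coeff s (suc i)) + a * coeff (r *ₚ s) i
        ≡⟨ *-distribˡ-+ a _ _ ⟨
      a * (b * coeff s (suc i) + coeff (r *ₚ s) i)
        ≡⟨ cong (a *_) (coeff-*-suc (b ∷ r) s i) ⟨
      a * coeff ((b ∷ r) *ₚ s) (suc i)
        ≡⟨ coeff-scale a ((b ∷ r) *ₚ s) (suc i) ⟨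
      coeff (scale a ((b ∷ r) *ₚ s)) (suc i)
        ∎ }
  where open ≡-Reasoning

*ₚ-distribʳ : ∀ r p p' → (p +ₚ p') *ₚ r ≋ p *ₚ r +ₚ p' *ₚ r
*ₚ-distribʳ r p p' = mk (λ i → go i p p')
  where
  open ≡-Reasoning
  tail-+ : ∀ p p' → tailₚ (p +ₚ p') ≋ tailₚ p +ₚ tailₚ p'
  tail-+ []      p'       = ≋-refl
  tail-+ (a ∷ p) []       = ≋-sym (+ₚ-identityʳ p)
  tail-+ (a ∷ p) (b ∷ p') = ≋-refl
  go : ∀ i p p' → coeff ((p +ₚ p') *ₚ r) i ≡ coeff (p *ₚ r +ₚ p' *ₚ r) i
  go zero p p' = begin
    coeff ((p +ₚ p') *ₚ r) 0                  ≡⟨ coeff-*-zero (p +ₚ p') r ⟩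
    coeff (p +ₚ p') 0 * coeff r 0             ≡⟨ cong (_* coeff r 0) (coeff-+ p p' 0) ⟩
    (coeff p 0 + coeff p' 0) * coeff r 0      ≡⟨ *-distribʳ-+ (coeff r 0) (coeff p 0) _ ⟩
    coeff p 0 * coeff r 0 + coeff p' 0 * coeff r 0
      ≡⟨ cong₂ _+_ (coeff-*-zero p r) (coeff-*-zero p' r) ⟨
    coeff (p *ₚ r) 0 + coeff (p' *ₚ r) 0      ≡⟨ coeff-+ (p *ₚ r) _ 0 ⟨
    coeff (p *ₚ r +ₚ p' *ₚ r) 0               ∎
  go (suc i) p p' = begin
    coeff ((p +ₚ p') *ₚ r) (suc i)
      ≡⟨ coeff-*-suc (p +ₚ p') r i ⟩
    coeff (p +ₚ p') 0 * rᵢ + coeff (tailₚ (p +ₚ p') *ₚ r) i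
      ≡⟨ cong₂ _+_ (trans (cong (_* rᵢ) (coeff-+ p p' 0)) (*-distribʳ-+ rᵢ (coeff p 0) _))
                   (trans (get (*ₚ-congˡ r (tail-+ p p')) i) (go i (tailₚ p) (tailₚ p'))) ⟩
    (coeff p 0 * rᵢ + coeff p' 0 * rᵢ) + coeff (tailₚ p *ₚ r +ₚ tailₚ p' *ₚ r) i
      ≡⟨ cong (coeff p 0 * rᵢ + coeff p' 0 * rᵢ +_) (coeff-+ (tailₚ p *ₚ r) _ i) ⟩
    (coeff p 0 * rᵢ + coeff p' 0 * rᵢ) + (coeff (tailₚ p *ₚ r) i + coeff (tailₚ p' *ₚ r) i)
      ≡⟨ +-assoc-middle (coeff p 0 * rᵢ) _ _ _ ⟩
    (coeff p 0 * rᵢ + coeff (tailₚ p *ₚ r) i) + (coeff p' 0 * rᵢ + coeff (tailₚ p' *ₚ r) i)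
      ≡⟨ cong₂ _+_ (coeff-*-suc p r i) (coeff-*-suc p' r i) ⟨
    coeff (p *ₚ r) (suc i) + coeff (p' *ₚ r) (suc i)
      ≡⟨ coeff-+ (p *ₚ r) _ (suc i) ⟨
    coeff (p *ₚ r +ₚ p' *ₚ r) (suc i)
      ∎
    where
    rᵢ = coeff r (suc i)
    +-assoc-middle : ∀ x y z w → (x + y) + (z + w) ≡ (x + z) + (y + w)
    +-assoc-middle x y z w = trans (+-assoc x y _) (trans (cong (x +_)
      (trans (sym (+-assoc y z w)) (trans (cong (_+ w) (+-comm y z)) (+-assoc z y w))))
      (sym (+-assoc x z _)))

*ₚ-assoc : ∀ p r s → (p *ₚ r) *ₚ s ≋ p *ₚ (r *ₚ s)
*ₚ-assoc []      r s = ≋-refl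
*ₚ-assoc (a ∷ p) r s =
  ≋-trans (*ₚ-distribʳ s (scale a r) (0 ∷ (p *ₚ r)))
          (+ₚ-cong (scale-*ₚ a r s) (≋-trans (cons0-*ₚ (p *ₚ r) s) (cons-cong (*ₚ-assoc p r s))))

*ₚ-congʳ : ∀ p {r r'} → r ≋ r' → p *ₚ r ≋ p *ₚ r'
*ₚ-congʳ p {r} {r'} e = ≋-trans (*ₚ-comm p r) (≋-trans (*ₚ-congˡ p e) (*ₚ-comm r' p))

*ₚ-cong : ∀ {p p' r r'} → p ≋ p' → r ≋ r' → p *ₚ r ≋ p' *ₚ r'
*ₚ-cong {p' = p'} {r = r} e f = ≋-trans (*ₚ-congˡ r e) (*ₚ-congʳ p' f)

*ₚ-identityˡ : ∀ p → one *ₚ p ≋ p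
*ₚ-identityˡ p = mk λ
  { zero    → trans (coeff-*-zero one p) (*-identityˡ _)
  ; (suc i) → trans (coeff-*-suc one p i) (trans (+-identityʳ _) (*-identityˡ _)) }

*ₚ-identityʳ : ∀ p → p *ₚ one ≋ p
*ₚ-identityʳ p = ≋-trans (*ₚ-comm p one) (*ₚ-identityˡ p)

polySemiring : CommutativeSemiring _ _
polySemiring = record
  { Carrier = Poly ; _≈_ = _≋_ ; _+_ = _+ₚ_ ; _*_ = _*ₚ_ ; 0# = [] ; 1# = one
  ; isCommutativeSemiring = isCommutativeSemiringˡ (record
     { +-isCommutativeMonoid = commutativeMonoid (λ e f → +ₚ-cong e f) +ₚ-assoc
         (λ _ → ≋-refl) +ₚ-identityʳ +ₚ-comm
     ; *-isCommutativeMonoid = commutativeMonoid *ₚ-cong *ₚ-assoc *ₚ-identityˡ *ₚ-identityʳ *ₚ-comm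
     ; distribʳ = *ₚ-distribʳ
     ; zeroˡ = λ _ → ≋-refl }) }
  where
  commutativeMonoid : ∀ {_∙_ : Poly → Poly → Poly} {ε : Poly} →
    (∀ {p p' r r'} → p ≋ p' → r ≋ r' → (p ∙ r) ≋ (p' ∙ r')) →
    (∀ p r s → ((p ∙ r) ∙ s) ≋ (p ∙ (r ∙ s))) →
    (∀ p → (ε ∙ p) ≋ p) → (∀ p → (p ∙ ε) ≋ p) → (∀ p r → (p ∙ r) ≋ (r ∙ p)) →
    IsCommutativeMonoid _≋_ _∙_ ε
  commutativeMonoid ∙-cong assoc idˡ idʳ comm = record
    { isMonoid = record
      { isSemigroup = record
        { isMagma = record
          { isEquivalence = record { refl = ≋-refl ; sym = ≋-sym ; trans = ≋-trans }
          ; ∙-cong = ∙-cong }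
        ; assoc = assoc }
      ; identity = idˡ , idʳ }
    ; comm = comm }

open CommutativeSemiring polySemiring using (distribˡ) renaming (setoid to ≋-setoid)

-- The ring solver over ℕ[q] (no decidable equality of constants is needed).
open import Tactic.RingSolver.NonReflective (fromCommutativeSemiring polySemiring (λ _ → nothing))

≡⇒≋ : ∀ {p r} → p ≡ r → p ≋ r
≡⇒≋ refl = ≋-refl

*ₚ-cancelʳ : ∀ K p r → NonZero (coeff K 0) → p *ₚ K ≋ r *ₚ K → p ≋ r
*ₚ-cancelʳ K p r k≢0 (mk e) = mk (λ i → go i p r e)
  where
  go : ∀ i p r → p *ₚ K ≈ₚ r *ₚ K → coeff p i ≡ coeff r i
  go zero p r e = *-cancelʳ-≡ (coeff p 0) (coeff r 0) (coeff K 0) {{k≢0}}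
    (trans (sym (coeff-*-zero p K)) (trans (e 0) (coeff-*-zero r K)))
  go (suc i) p r e =
    trans (sym (coeff-tailₚ p i)) (trans (go i (tailₚ p) (tailₚ r) tails) (coeff-tailₚ r i))
    where
    -- the constant terms agree, so the remaining terms of p K and r K agree
    tails : tailₚ p *ₚ K ≈ₚ tailₚ r *ₚ K
    tails j = +-cancelˡ-≡ (coeff r 0 * coeff K (suc j)) _ _
      (trans (cong (λ c → c * coeff K (suc j) + coeff (tailₚ p *ₚ K) j) (sym (go zero p r e)))
      (trans (sym (coeff-*-suc p K j)) (trans (e (suc j)) (coeff-*-suc r K j))))

qpow : ℕ → Poly
qpow k = qpow* k one

qpow*≋qpow-*ₚ : ∀ k p → qpow* k p ≋ qpow k *ₚ p
qpow*≋qpow-*ₚ zero    p = ≋-sym (*ₚ-identityˡ p)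
qpow*≋qpow-*ₚ (suc k) p = ≋-trans (cons-cong (qpow*≋qpow-*ₚ k p)) (≋-sym (cons0-*ₚ (qpow k) p))

qpow*-cong : ∀ k {p p'} → p ≋ p' → qpow* k p ≋ qpow* k p'
qpow*-cong zero    e = e
qpow*-cong (suc k) e = cons-cong (qpow*-cong k e)

qpow*-+ : ∀ r k p → qpow* (r + k) p ≡ qpow* r (qpow* k p)
qpow*-+ zero    k p = refl
qpow*-+ (suc r) k p = cong (0 ∷_) (qpow*-+ r k p)

qint-+ : ∀ m k → qint m +ₚ qpow* m (qint k) ≡ qint (m + k)
qint-+ zero    k = refl
qint-+ (suc m) k = cong (1 ∷_) (qint-+ m k)

qfac : ℕ → Poly
qfac zero    = one
qfac (suc n) = qint (suc n) *ₚ qfac n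

qbinom : ℕ → ℕ → Poly
qbinom zero    b       = one
qbinom (suc a) zero    = one
qbinom (suc a) (suc b) = qpow* (suc b) (qbinom a (suc b)) +ₚ qbinom (suc a) b

-- C(a,b) [a]! [b]! = [a+b]!, by the q-Pascal recursion and [b+1] + q^(b+1)[a+1] = [a+b+2].
qbinom-qfac : ∀ a b → qbinom a b *ₚ (qfac a *ₚ qfac b) ≋ qfac (a + b)
qbinom-qfac zero    b    = ≋-trans (*ₚ-identityˡ _) (*ₚ-identityˡ _)
qbinom-qfac (suc a) zero =
  ≋-trans (*ₚ-identityˡ _) (≋-trans (*ₚ-identityʳ _) (≡⇒≋ (cong qfac (sym (+-identityʳ (suc a))))))
qbinom-qfac (suc a) (suc b) = begin
    (qpow* (suc b) C₁ +ₚ C₂) *ₚ (qfac (suc a) *ₚ qfac (suc b))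
  ≈⟨ *ₚ-congˡ (qfac (suc a) *ₚ qfac (suc b)) (+ₚ-congˡ C₂ (qpow*≋qpow-*ₚ (suc b) C₁)) ⟩
    (qpow (suc b) *ₚ C₁ +ₚ C₂) *ₚ ((qint (suc a) *ₚ qfac a) *ₚ (qint (suc b) *ₚ qfac b))
  ≈⟨ solve 7 (λ Q S₁ S₂ A FA B FB → (Q ⊗ S₁ ⊕ S₂) ⊗ ((A ⊗ FA) ⊗ (B ⊗ FB))
                ⊜ (Q ⊗ A ⊗ (S₁ ⊗ (FA ⊗ (B ⊗ FB))) ⊕ B ⊗ (S₂ ⊗ ((A ⊗ FA) ⊗ FB))))
       ≋-refl (qpow (suc b)) C₁ C₂ (qint (suc a)) (qfac a) (qint (suc b)) (qfac b) ⟩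
    qpow (suc b) *ₚ qint (suc a) *ₚ (C₁ *ₚ (qfac a *ₚ qfac (suc b)))
      +ₚ qint (suc b) *ₚ (C₂ *ₚ (qfac (suc a) *ₚ qfac b))
  ≈⟨ +ₚ-cong (*ₚ-congʳ (qpow (suc b) *ₚ qint (suc a)) (qbinom-qfac a (suc b)))
             (*ₚ-congʳ (qint (suc b)) (qbinom-qfac (suc a) b)) ⟩
    qpow (suc b) *ₚ qint (suc a) *ₚ qfac (a + suc b) +ₚ qint (suc b) *ₚ qfac (suc a + b)
  ≡⟨ cong (λ n → qpow (suc b) *ₚ qint (suc a) *ₚ qfac n +ₚ qint (suc b) *ₚ qfac (suc a + b)) (+-suc a b) ⟩
    qpow (suc b) *ₚ qint (suc a) *ₚ qfac (suc a + b) +ₚ qint (suc b) *ₚ qfac (suc a + b)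
  ≈⟨ solve 4 (λ Q A X B → (Q ⊗ A ⊗ X ⊕ B ⊗ X) ⊜ (B ⊕ Q ⊗ A) ⊗ X)
       ≋-refl (qpow (suc b)) (qint (suc a)) (qfac (suc a + b)) (qint (suc b)) ⟩
    (qint (suc b) +ₚ qpow (suc b) *ₚ qint (suc a)) *ₚ qfac (suc a + b)
  ≈⟨ *ₚ-congˡ (qfac (suc a + b)) (+ₚ-congʳ (qint (suc b)) (≋-sym (qpow*≋qpow-*ₚ (suc b) (qint (suc a))))) ⟩
    (qint (suc b) +ₚ qpow* (suc b) (qint (suc a))) *ₚ qfac (suc a + b)
  ≡⟨ cong (_*ₚ qfac (suc a + b)) (qint-+ (suc b) (suc a)) ⟩
    qint (suc b + suc a) *ₚ qfac (suc a + b)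
  ≡⟨ cong (λ n → qint n *ₚ qfac (suc a + b)) (trans (+-comm (suc b) (suc a)) (cong suc (+-suc a b))) ⟩
    qfac (suc (suc a + b))
  ≡⟨ cong (λ n → qfac (suc n)) (+-suc a b) ⟨
    qfac (suc a + suc b)
  ∎
  where
  open SetoidReasoning ≋-setoid
  C₁ = qbinom a (suc b)
  C₂ = qbinom (suc a) b

Qᶠ : List Tree → Poly
Qᶠ F = Q (node F)

edgesF-++ : ∀ F G → edgesF (F ++ G) ≡ edgesF F + edgesF G
edgesF-++ []      G = refl
edgesF-++ (t ∷ F) G =
  trans (cong (suc (edges t) +_) (edgesF-++ F G)) (sym (+-assoc (suc (edges t)) (edgesF F) _))

mutual
  plucks-edges : ∀ t → All (λ x → suc (edges (proj₂ x)) ≡ edges t) (plucks t)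
  plucks-edges (node ts) = map⁺ (plucksF-edges ts)

  plucksF-edges : ∀ F → All (λ x → suc (edgesF (proj₂ x)) ≡ edgesF F) (plucksF F)
  plucksF-edges []       = []
  plucksF-edges (t ∷ ts) = ++⁺ (here-edges t ts) (map⁺ (All.map
    (λ {x} e → trans (sym (+-suc (suc (edges t)) (edgesF (proj₂ x)))) (cong (suc (edges t) +_) e))
    (plucksF-edges ts)))

  here-edges : ∀ t ts → All (λ x → suc (edgesF (proj₂ x)) ≡ suc (edges t) + edgesF ts) (here t ts)
  here-edges (node [])       ts = refl ∷ []
  here-edges (node (c ∷ cs)) ts =
    map⁺ (All.map (λ e → cong (λ k → suc (k + edgesF ts)) e) (plucks-edges (node (c ∷ cs))))

sumₚ-++ : ∀ xs ys → sumₚ (xs ++ ys) ≋ sumₚ xs +ₚ sumₚ ys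
sumₚ-++ []       ys = ≋-refl
sumₚ-++ (x ∷ xs) ys = ≋-trans (+ₚ-congʳ x (sumₚ-++ xs ys)) (≋-sym (+ₚ-assoc x (sumₚ xs) (sumₚ ys)))

sumₚ-cong : ∀ {A : Set} {f g : A → Poly} (xs : List A) →
  All (λ x → f x ≋ g x) xs → sumₚ (map f xs) ≋ sumₚ (map g xs)
sumₚ-cong []       []       = ≋-refl
sumₚ-cong (x ∷ xs) (e ∷ es) = +ₚ-cong e (sumₚ-cong xs es)

sumₚ-scale : ∀ {A : Set} (c : Poly) (f : A → Poly) (xs : List A) →
  sumₚ (map (λ x → c *ₚ f x) xs) ≋ c *ₚ sumₚ (map f xs)
sumₚ-scale c f []       = ≋-sym (*ₚ-zeroʳ c)
sumₚ-scale c f (x ∷ xs) =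
  ≋-trans (+ₚ-congʳ (c *ₚ f x) (sumₚ-scale c f xs)) (≋-sym (distribˡ c (f x) _))

Σleaves : (ℕ × List Tree → Poly) → List Tree → Poly
Σleaves f F = sumₚ (map f (plucksF F))

pluckTerm : ℕ × List Tree → Poly
pluckTerm x = qpow* (proj₁ x) (Qᶠ (proj₂ x))

Qᶠ-unfold : ∀ m F → edgesF F ≡ suc m → Qᶠ F ≋ Σleaves pluckTerm F
Qᶠ-unfold m F eq = begin
    Qᶠ F
  ≡⟨ cong (λ k → Qfuel k (node F)) eq ⟩
    Qfuel (suc m) (node F)
  ≡⟨ cong sumₚ (map-∘ (plucksF F)) ⟨
    Σleaves (λ x → qpow* (proj₁ x) (Qfuel m (node (proj₂ x)))) F
  ≈⟨ sumₚ-cong (plucksF F) (All.map (λ {x} e → ≡⇒≋ (cong (λ k → qpow* (proj₁ x) (Qfuel k (node (proj₂ x))))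
                                         (sym (suc-injective (trans e eq))))) (plucksF-edges F)) ⟩
    Σleaves pluckTerm F
  ∎
  where open SetoidReasoning ≋-setoid

-- A leaf of F ++ G is a leaf of F, with the edges of G added to its right, or
-- a leaf of G.
here-++ : ∀ t ts G (f : ℕ × List Tree → Poly) →
  map f (here t (ts ++ G)) ≡ map (λ x → f (proj₁ x + edgesF G , proj₂ x ++ G)) (here t ts)
here-++ (node [])       ts G f = cong (λ k → f (k , ts ++ G) ∷ []) (edgesF-++ ts G)
here-++ (node (c ∷ cs)) ts G f = begin
    map f (map _ (plucks (node (c ∷ cs))))
  ≡⟨ map-∘ (plucks (node (c ∷ cs))) ⟨
    map _ (plucks (node (c ∷ cs)))
  ≡⟨ map-cong (λ x → cong (λ k → f (k , proj₂ x ∷ ts ++ G)) (rightEdges (proj₁ x))) (plucks (node (c ∷ cs))) ⟩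
    map _ (plucks (node (c ∷ cs)))
  ≡⟨ map-∘ (plucks (node (c ∷ cs))) ⟩
    map (λ x → f (proj₁ x + edgesF G , proj₂ x ++ G)) (here (node (c ∷ cs)) ts)
  ∎
  where
  open ≡-Reasoning
  rightEdges : ∀ r → r + edgesF (ts ++ G) ≡ r + edgesF ts + edgesF G
  rightEdges r = trans (cong (r +_) (edgesF-++ ts G)) (sym (+-assoc r _ _))

Σleaves-++ : ∀ F G (f : ℕ × List Tree → Poly) →
  Σleaves f (F ++ G) ≋
    Σleaves (λ x → f (proj₁ x + edgesF G , proj₂ x ++ G)) F +ₚ Σleaves (λ x → f (proj₁ x , F ++ proj₂ x)) G
Σleaves-++ []       G f = ≋-refl
Σleaves-++ (t ∷ ts) G f = begin
    sumₚ (map f (here t (ts ++ G) ++ map (λ { (r , ts') → (r , t ∷ ts') }) (plucksF (ts ++ G))))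
  ≡⟨ cong sumₚ (map-++ f (here t (ts ++ G)) _) ⟩
    sumₚ (map f (here t (ts ++ G)) ++ map f (map (λ { (r , ts') → (r , t ∷ ts') }) (plucksF (ts ++ G))))
  ≈⟨ sumₚ-++ (map f (here t (ts ++ G))) _ ⟩
    sumₚ (map f (here t (ts ++ G))) +ₚ sumₚ (map f (map (λ { (r , ts') → (r , t ∷ ts') }) (plucksF (ts ++ G))))
  ≡⟨ cong₂ _+ₚ_ (cong sumₚ (here-++ t ts G f)) (cong sumₚ (sym (map-∘ (plucksF (ts ++ G))))) ⟩
    sumₚ (map f₁ (here t ts)) +ₚ Σleaves (λ x → f (proj₁ x , t ∷ proj₂ x)) (ts ++ G)
  ≈⟨ +ₚ-congʳ (sumₚ (map f₁ (here t ts))) (Σleaves-++ ts G (λ x → f (proj₁ x , t ∷ proj₂ x))) ⟩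
    sumₚ (map f₁ (here t ts)) +ₚ (Σleaves (λ x → f₁ (proj₁ x , t ∷ proj₂ x)) ts +ₚ Σleaves f₂ G)
  ≈⟨ +ₚ-assoc (sumₚ (map f₁ (here t ts))) _ _ ⟨
    (sumₚ (map f₁ (here t ts)) +ₚ Σleaves (λ x → f₁ (proj₁ x , t ∷ proj₂ x)) ts) +ₚ Σleaves f₂ G
  ≈⟨ +ₚ-congˡ (Σleaves f₂ G) (sumₚ-++ (map f₁ (here t ts)) _) ⟨
    sumₚ (map f₁ (here t ts) ++ map (λ x → f₁ (proj₁ x , t ∷ proj₂ x)) (plucksF ts)) +ₚ Σleaves f₂ G
  ≡⟨ cong (λ z → sumₚ z +ₚ Σleaves f₂ G)
       (trans (cong (map f₁ (here t ts) ++_) (map-∘ (plucksF ts))) (sym (map-++ f₁ (here t ts) _))) ⟩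
    Σleaves f₁ (t ∷ ts) +ₚ Σleaves f₂ G
  ∎
  where
  open SetoidReasoning ≋-setoid
  f₁ f₂ : ℕ × List Tree → Poly
  f₁ x = f (proj₁ x + edgesF G , proj₂ x ++ G)
  f₂ x = f (proj₁ x , (t ∷ ts) ++ proj₂ x)

Wedge : List Tree → List Tree → Set
Wedge F G = Qᶠ (F ++ G) ≋ qbinom (edgesF F) (edgesF G) *ₚ (Qᶠ F *ₚ Qᶠ G)

-- The term of a leaf plucked from F (leaving F'), given the wedge formula for F' and G;
-- the q^|E(G)| records the edges of G to the right of the leaf.
wedge-leftTerm : ∀ a r F' G → edgesF F' ≡ a → Wedge F' G →
  pluckTerm (r + edgesF G , F' ++ G) ≋ (qpow (edgesF G) *ₚ (qbinom a (edgesF G) *ₚ Qᶠ G)) *ₚ pluckTerm (r , F')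
wedge-leftTerm _ r F' G refl wedge-F'G = begin
    qpow* (r + g) (Qᶠ (F' ++ G))
  ≡⟨ qpow*-+ r g _ ⟩
    qpow* r (qpow* g (Qᶠ (F' ++ G)))
  ≈⟨ ≋-trans (qpow*≋qpow-*ₚ r _) (*ₚ-congʳ (qpow r) (qpow*≋qpow-*ₚ g _)) ⟩
    qpow r *ₚ (qpow g *ₚ Qᶠ (F' ++ G))
  ≈⟨ *ₚ-congʳ (qpow r) (*ₚ-congʳ (qpow g) wedge-F'G) ⟩
    qpow r *ₚ (qpow g *ₚ (C *ₚ (Qᶠ F' *ₚ Qᶠ G)))
  ≈⟨ solve 5 (λ R Q C X Y → R ⊗ (Q ⊗ (C ⊗ (X ⊗ Y))) ⊜ (Q ⊗ (C ⊗ Y)) ⊗ (R ⊗ X))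
       ≋-refl (qpow r) (qpow g) C (Qᶠ F') (Qᶠ G) ⟩
    (qpow g *ₚ (C *ₚ Qᶠ G)) *ₚ (qpow r *ₚ Qᶠ F')
  ≈⟨ *ₚ-congʳ (qpow g *ₚ (C *ₚ Qᶠ G)) (qpow*≋qpow-*ₚ r (Qᶠ F')) ⟨
    (qpow g *ₚ (C *ₚ Qᶠ G)) *ₚ qpow* r (Qᶠ F')
  ∎
  where
  open SetoidReasoning ≋-setoid
  g = edgesF G
  C = qbinom (edgesF F') g

wedge-rightTerm : ∀ b r F G' → edgesF G' ≡ b → Wedge F G' →
  pluckTerm (r , F ++ G') ≋ (qbinom (edgesF F) b *ₚ Qᶠ F) *ₚ pluckTerm (r , G')
wedge-rightTerm _ r F G' refl wedge-FG' = begin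
    qpow* r (Qᶠ (F ++ G'))
  ≈⟨ qpow*≋qpow-*ₚ r _ ⟩
    qpow r *ₚ Qᶠ (F ++ G')
  ≈⟨ *ₚ-congʳ (qpow r) wedge-FG' ⟩
    qpow r *ₚ (C *ₚ (Qᶠ F *ₚ Qᶠ G'))
  ≈⟨ solve 4 (λ R C X Y → R ⊗ (C ⊗ (X ⊗ Y)) ⊜ (C ⊗ X) ⊗ (R ⊗ Y)) ≋-refl (qpow r) C (Qᶠ F) (Qᶠ G') ⟩
    (C *ₚ Qᶠ F) *ₚ (qpow r *ₚ Qᶠ G')
  ≈⟨ *ₚ-congʳ (C *ₚ Qᶠ F) (qpow*≋qpow-*ₚ r (Qᶠ G')) ⟨
    (C *ₚ Qᶠ F) *ₚ qpow* r (Qᶠ G')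
  ∎
  where
  open SetoidReasoning ≋-setoid
  C = qbinom (edgesF F) (edgesF G')

-- Induction on the total number of edges; the two sums of leaf terms recombine
-- through the q-Pascal recursion of qbinom.
wedge-bounded : ∀ n F G → edgesF F + edgesF G ≡ n → Wedge F G
wedge-bounded n []       G        _ = ≋-sym (≋-trans (*ₚ-identityˡ _) (*ₚ-identityˡ _))
wedge-bounded n (t ∷ ts) []       _ =
  ≋-trans (≡⇒≋ (cong Qᶠ (++-identityʳ (t ∷ ts)))) (≋-sym (≋-trans (*ₚ-identityˡ _) (*ₚ-identityʳ _)))
wedge-bounded zero    (t ∷ ts) (u ∷ us) ()
wedge-bounded (suc m) (t ∷ ts) (u ∷ us) size = begin
    Qᶠ (F ++ G)
  ≈⟨ Qᶠ-unfold m (F ++ G) (trans (edgesF-++ F G) size) ⟩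
    Σleaves pluckTerm (F ++ G)
  ≈⟨ Σleaves-++ F G pluckTerm ⟩
    Σleaves (λ x → pluckTerm (proj₁ x + g , proj₂ x ++ G)) F +ₚ Σleaves (λ x → pluckTerm (proj₁ x , F ++ proj₂ x)) G
  ≈⟨ +ₚ-cong (sumₚ-cong (plucksF F) (All.map (λ {x} → leftTerm {x}) (plucksF-edges F)))
             (sumₚ-cong (plucksF G) (All.map (λ {x} → rightTerm {x}) (plucksF-edges G))) ⟩
    Σleaves (λ x → c₁ *ₚ pluckTerm x) F +ₚ Σleaves (λ x → c₂ *ₚ pluckTerm x) G
  ≈⟨ +ₚ-cong (sumₚ-scale c₁ pluckTerm (plucksF F)) (sumₚ-scale c₂ pluckTerm (plucksF G)) ⟩
    c₁ *ₚ Σleaves pluckTerm F +ₚ c₂ *ₚ Σleaves pluckTerm G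
  ≈⟨ +ₚ-cong (*ₚ-congʳ c₁ (Qᶠ-unfold a F refl)) (*ₚ-congʳ c₂ (Qᶠ-unfold b G refl)) ⟨
    c₁ *ₚ Qᶠ F +ₚ c₂ *ₚ Qᶠ G
  ≈⟨ solve 5 (λ Q C₁ C₂ X Y → ((Q ⊗ (C₁ ⊗ Y)) ⊗ X ⊕ (C₂ ⊗ X) ⊗ Y) ⊜ (Q ⊗ C₁ ⊕ C₂) ⊗ (X ⊗ Y))
       ≋-refl (qpow g) (qbinom a g) (qbinom (suc a) b) (Qᶠ F) (Qᶠ G) ⟩
    (qpow g *ₚ qbinom a g +ₚ qbinom (suc a) b) *ₚ (Qᶠ F *ₚ Qᶠ G)
  ≈⟨ *ₚ-congˡ (Qᶠ F *ₚ Qᶠ G) (+ₚ-congˡ (qbinom (suc a) b) (qpow*≋qpow-*ₚ g (qbinom a g))) ⟨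
    qbinom (suc a) (suc b) *ₚ (Qᶠ F *ₚ Qᶠ G)
  ∎
  where
  open SetoidReasoning ≋-setoid
  F = t ∷ ts
  G = u ∷ us
  a = edges t + edgesF ts
  b = edges u + edgesF us
  g = suc b
  c₁ = qpow g *ₚ (qbinom a g *ₚ Qᶠ G)
  c₂ = qbinom (suc a) b *ₚ Qᶠ F
  leftTerm : ∀ {x} → suc (edgesF (proj₂ x)) ≡ suc a →
    pluckTerm (proj₁ x + g , proj₂ x ++ G) ≋ c₁ *ₚ pluckTerm x
  leftTerm {r , F'} e = wedge-leftTerm a r F' G (suc-injective e)
    (wedge-bounded m F' G (suc-injective (trans (cong (_+ g) e) size)))
  rightTerm : ∀ {x} → suc (edgesF (proj₂ x)) ≡ suc b →
    pluckTerm (proj₁ x , F ++ proj₂ x) ≋ c₂ *ₚ pluckTerm x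
  rightTerm {r , G'} e = wedge-rightTerm b r F G' (suc-injective e)
    (wedge-bounded m F G' (suc-injective (trans (sym (+-suc (suc a) (edgesF G'))) (trans (cong (suc a +_) e) size))))

wedge : ∀ F G → Wedge F G
wedge F G = wedge-bounded _ F G refl

-- The stem formula: putting a new root below the root changes nothing, since
-- the leaves are the same and the new edge is never to the right of a path.
stem-bounded : ∀ n cs → edgesF cs ≡ n → Qᶠ (node cs ∷ []) ≋ Qᶠ cs
stem-bounded n       []        _ = ≋-refl
stem-bounded zero    (c ∷ cs') ()
stem-bounded (suc m) (c ∷ cs') size = begin
    Qᶠ (node cs ∷ [])
  ≈⟨ Qᶠ-unfold (edgesF cs) (node cs ∷ []) (cong suc (+-identityʳ _)) ⟩
    sumₚ (map pluckTerm (here (node cs) [] ++ []))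
  ≡⟨ cong (λ z → sumₚ (map pluckTerm z)) (++-identityʳ (here (node cs) [])) ⟩
    sumₚ (map pluckTerm (map onlyChild (map asTree (plucksF cs))))
  ≡⟨ cong sumₚ (trans (map-∘ (plucksF cs)) (map-∘ (map asTree (plucksF cs)))) ⟨
    Σleaves (λ x → pluckTerm (proj₁ x + 0 , node (proj₂ x) ∷ [])) cs
  ≈⟨ sumₚ-cong (plucksF cs) (All.map (λ {x} → stemTerm {x}) (plucksF-edges cs)) ⟩
    Σleaves pluckTerm cs
  ≈⟨ Qᶠ-unfold m cs size ⟨
    Qᶠ cs
  ∎
  where
  open SetoidReasoning ≋-setoid
  cs = c ∷ cs'
  asTree : ℕ × List Tree → ℕ × Tree
  asTree (r , F) = (r , node F)
  onlyChild : ℕ × Tree → ℕ × List Tree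
  onlyChild (r , t) = (r + 0 , t ∷ [])
  stemTerm : ∀ {x} → suc (edgesF (proj₂ x)) ≡ edgesF cs →
    pluckTerm (proj₁ x + 0 , node (proj₂ x) ∷ []) ≋ pluckTerm x
  stemTerm {r , F'} e = ≋-trans (≡⇒≋ (cong (λ k → qpow* k (Qᶠ (node F' ∷ []))) (+-identityʳ r)))
    (qpow*-cong r (stem-bounded m F' (suc-injective (trans e size))))

Qᶠ-stem : ∀ cs → Qᶠ (node cs ∷ []) ≋ Qᶠ cs
Qᶠ-stem cs = stem-bounded _ cs refl

-- The hook polynomial of a forest: the product over its vertices v of
-- [number of vertices of the subtree at v]_q.
hooksF : List Tree → Poly
hooksF []             = one
hooksF (node cs ∷ ts) = (qint (suc (edgesF cs)) *ₚ hooksF cs) *ₚ hooksF ts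

hooksF-++ : ∀ F G → hooksF (F ++ G) ≋ hooksF F *ₚ hooksF G
hooksF-++ []             G = ≋-sym (*ₚ-identityˡ (hooksF G))
hooksF-++ (node cs ∷ ts) G = ≋-trans (*ₚ-congʳ (qint (suc (edgesF cs)) *ₚ hooksF cs) (hooksF-++ ts G))
                                     (≋-sym (*ₚ-assoc (qint (suc (edgesF cs)) *ₚ hooksF cs) (hooksF ts) (hooksF G)))

hooksF-const : ∀ F → coeff (hooksF F) 0 ≡ 1
hooksF-const []             = refl
hooksF-const (node cs ∷ ts) = trans (coeff-*-zero (qint (suc (edgesF cs)) *ₚ hooksF cs) (hooksF ts))
  (cong₂ _*_ (trans (coeff-*-zero (qint (suc (edgesF cs))) (hooksF cs)) (cong (1 *_) (hooksF-const cs)))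
             (hooksF-const ts))

-- The q-hook-length formula  Q(T) · ∏_{v ≠ root} [hook v]_q = [|E(T)|]_q!,
-- by the wedge formula for the first subtree and the rest, and the stem formula.
hook-length : ∀ F → Qᶠ F *ₚ hooksF F ≋ qfac (edgesF F)
hook-length []             = *ₚ-identityˡ one
hook-length (node cs ∷ ts) = begin
    Qᶠ (node cs ∷ ts) *ₚ H
  ≈⟨ *ₚ-congˡ H (wedge (node cs ∷ []) ts) ⟩
    (qbinom (suc (c + 0)) t *ₚ (Qᶠ (node cs ∷ []) *ₚ Qᶠ ts)) *ₚ H
  ≡⟨ cong (λ n → (qbinom (suc n) t *ₚ (Qᶠ (node cs ∷ []) *ₚ Qᶠ ts)) *ₚ H) (+-identityʳ c) ⟩
    (qbinom (suc c) t *ₚ (Qᶠ (node cs ∷ []) *ₚ Qᶠ ts)) *ₚ H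
  ≈⟨ *ₚ-congˡ H (*ₚ-congʳ (qbinom (suc c) t) (*ₚ-congˡ (Qᶠ ts) (Qᶠ-stem cs))) ⟩
    (qbinom (suc c) t *ₚ (Qᶠ cs *ₚ Qᶠ ts)) *ₚ ((qint (suc c) *ₚ hooksF cs) *ₚ hooksF ts)
  ≈⟨ solve 6 (λ B X Y I h k → (B ⊗ (X ⊗ Y)) ⊗ ((I ⊗ h) ⊗ k) ⊜ B ⊗ ((I ⊗ (X ⊗ h)) ⊗ (Y ⊗ k)))
       ≋-refl (qbinom (suc c) t) (Qᶠ cs) (Qᶠ ts) (qint (suc c)) (hooksF cs) (hooksF ts) ⟩
    qbinom (suc c) t *ₚ ((qint (suc c) *ₚ (Qᶠ cs *ₚ hooksF cs)) *ₚ (Qᶠ ts *ₚ hooksF ts))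
  ≈⟨ *ₚ-congʳ (qbinom (suc c) t) (*ₚ-cong (*ₚ-congʳ (qint (suc c)) (hook-length cs)) (hook-length ts)) ⟩
    qbinom (suc c) t *ₚ (qfac (suc c) *ₚ qfac t)
  ≈⟨ qbinom-qfac (suc c) t ⟩
    qfac (suc c + t)
  ∎
  where
  open SetoidReasoning ≋-setoid
  c = edgesF cs
  t = edgesF ts
  H = (qint (suc c) *ₚ hooksF cs) *ₚ hooksF ts

-- T rooted at v₁ with children A ++ v₂ ∷ B, where v₂ carries D.  Its hooks are
-- those of A, D and B together with the hook |E(D)| + 1 of v₂, so the
-- hook-length formula reads as follows.
edge-hook-formula : ∀ A D B →
  (qint (edgesF D + 1) *ₚ Qᶠ (A ++ node D ∷ B)) *ₚ (hooksF A *ₚ hooksF D *ₚ hooksF B)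
    ≋ qfac (suc (edgesF A + edgesF D + edgesF B))
edge-hook-formula A D B = begin
    (qint (d + 1) *ₚ Qᶠ T) *ₚ (hooksF A *ₚ hooksF D *ₚ hooksF B)
  ≡⟨ cong (λ n → (qint n *ₚ Qᶠ T) *ₚ (hooksF A *ₚ hooksF D *ₚ hooksF B)) (+-comm d 1) ⟩
    (qint (suc d) *ₚ Qᶠ T) *ₚ (hooksF A *ₚ hooksF D *ₚ hooksF B)
  ≈⟨ solve 5 (λ I X a δ b → (I ⊗ X) ⊗ (a ⊗ δ ⊗ b) ⊜ X ⊗ (a ⊗ ((I ⊗ δ) ⊗ b)))
       ≋-refl (qint (suc d)) (Qᶠ T) (hooksF A) (hooksF D) (hooksF B) ⟩
    Qᶠ T *ₚ (hooksF A *ₚ hooksF (node D ∷ B))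
  ≈⟨ *ₚ-congʳ (Qᶠ T) (hooksF-++ A (node D ∷ B)) ⟨
    Qᶠ T *ₚ hooksF T
  ≈⟨ hook-length T ⟩
    qfac (edgesF T)
  ≡⟨ cong qfac (trans (edgesF-++ A (node D ∷ B)) (trans (+-suc a (d + b)) (cong suc (sym (+-assoc a d b))))) ⟩
    qfac (suc (a + d + b))
  ∎
  where
  open SetoidReasoning ≋-setoid
  T = A ++ node D ∷ B
  a = edgesF A
  d = edgesF D
  b = edgesF B

-- Both rootings have the same hooks away from e: those of the forests ls, cs, rs.
hooks-away-from-e : ∀ ls cs rs →
  hooksF cs *ₚ hooksF (ls ++ rs) *ₚ hooksF [] ≋ hooksF ls *ₚ hooksF cs *ₚ hooksF rs
hooks-away-from-e ls cs rs =
  ≋-trans (*ₚ-congˡ one (*ₚ-congʳ (hooksF cs) (hooksF-++ ls rs)))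
    (solve 3 (λ a c b → c ⊗ (a ⊗ b) ⊗ Κ one ⊜ a ⊗ c ⊗ b) ≋-refl (hooksF ls) (hooksF cs) (hooksF rs))

-- ... and the same number of edges away from e.
edges-away-from-e : ∀ ls cs rs →
  edgesF ls + edgesF cs + edgesF rs ≡ edgesF cs + edgesF (ls ++ rs) + edgesF []
edges-away-from-e ls cs rs = begin
    l + c + r      ≡⟨ cong (_+ r) (+-comm l c) ⟩
    c + l + r      ≡⟨ +-assoc c l r ⟩
    c + (l + r)    ≡⟨ cong (c +_) (edgesF-++ ls rs) ⟨
    c + edgesF (ls ++ rs)      ≡⟨ +-identityʳ _ ⟨
    c + edgesF (ls ++ rs) + 0  ∎
  where
  open ≡-Reasoning
  l = edgesF ls
  c = edgesF cs
  r = edgesF rs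

corollary2p3 : (ls rs cs : List Tree) →
    qint (edgesF cs + 1) *ₚ Q (node (ls ++ node cs ∷ rs))
      ≈ₚ qint (edgesF (ls ++ rs) + 1) *ₚ Q (node (cs ++ node (ls ++ rs) ∷ []))
corollary2p3 ls rs cs = get (*ₚ-cancelʳ H rootedAt-v₁ rootedAt-v₂ H-nonzero (begin
    rootedAt-v₁ *ₚ H
  ≈⟨ edge-hook-formula ls cs rs ⟩
    qfac (suc (edgesF ls + edgesF cs + edgesF rs))
  ≡⟨ cong (λ n → qfac (suc n)) (edges-away-from-e ls cs rs) ⟩
    qfac (suc (edgesF cs + edgesF (ls ++ rs) + edgesF []))
  ≈⟨ edge-hook-formula cs (ls ++ rs) [] ⟨
    rootedAt-v₂ *ₚ (hooksF cs *ₚ hooksF (ls ++ rs) *ₚ hooksF [])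
  ≈⟨ *ₚ-congʳ rootedAt-v₂ (hooks-away-from-e ls cs rs) ⟩
    rootedAt-v₂ *ₚ H
  ∎))
  where
  open SetoidReasoning ≋-setoid
  rootedAt-v₁ rootedAt-v₂ H : Poly
  rootedAt-v₁ = qint (edgesF cs + 1) *ₚ Q (node (ls ++ node cs ∷ rs))
  rootedAt-v₂ = qint (edgesF (ls ++ rs) + 1) *ₚ Q (node (cs ++ node (ls ++ rs) ∷ []))
  H = hooksF ls *ₚ hooksF cs *ₚ hooksF rs
  H-nonzero : NonZero (coeff H 0)
  H-nonzero = subst NonZero (sym (trans (coeff-*-zero (hooksF ls *ₚ hooksF cs) (hooksF rs))
    (cong₂ _*_ (trans (coeff-*-zero (hooksF ls) (hooksF cs)) (cong₂ _*_ (hooksF-const ls) (hooksF-const cs)))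
               (hooksF-const rs)))) _
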